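{- Let $S$ and $R$ be sock orderings where $S$ contains no sandwich and $S$ contains at least three colors. Suppose the state $(S,R)$ is terminal. If $b$ and $t$ are the top two colors of $S$ ($t$ on top, $b$ directly beneath it), then there exists a color $a$ occurring in $S$, distinct from $b$ and $t$, such that the state $(abt,R)$ is terminal.
   Context: Sock orderings are finite words of colored socks written as words over colors; $Y\subseteq X$ means $Y$ is a subsequence of $X$. A state $(S,R)$ of foot-sorting has stack content $S$ (left to right = bottom to top) and remaining input $R$; $(abt,R)$ denotes the state whose stack has $a$ at the bottom, then $b$, then $t$ on top. A sandwich is a word $uvu$ with colors $u\neq v$; it blocks a color $z\notin\{u,v\}$ in $W$ if $uvuz\subseteq W$. As $S$ has no sandwich, socks of each color in $S$ are consecutive and "top colors" refers to these blocks. A color $x$ in $SR$ is sortable in $(S,R)$ if no sock of another color lies above a sock of color $x$ in $S$ and, if $x$ occurs in $R$, $x$ is not blocked by any sandwich in $SR$. A state is terminal if no color is sortable in it. -}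

module Defs where

open import Data.Nat using (ℕ; suc)
open import Data.List using (List; []; _∷_; _++_; replicate)
open import Data.List.Membership.Propositional using (_∈_)
open import Data.List.Relation.Binary.Sublist.Propositional using (_⊆_)
open import Data.Product using (Σ; ∃; ∃-syntax; _×_; _,_)
open import Relation.Binary.PropositionalEquality using (_≡_; _≢_)
open import Relation.Nullary using (¬_)

Color : Set
Color = ℕ

Word : Set
Word = List Color

HasSandwich : Word → Set
HasSandwich W = ∃[ u ] ∃[ v ] (u ≢ v × (u ∷ v ∷ u ∷ []) ⊆ W)

Blocked : Word → Color → Set
Blocked W z = ∃[ u ] ∃[ v ] (u ≢ v × z ≢ u × z ≢ v × (u ∷ v ∷ u ∷ z ∷ []) ⊆ W)

-- x is sortable in the state (S , R)  (S listed bottom to top).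
Sortable : Word → Word → Color → Set
Sortable S R x =
  x ∈ (S ++ R)
  × (∀ y → y ≢ x → ¬ ((x ∷ y ∷ []) ⊆ S))
  × (x ∈ R → ¬ Blocked (S ++ R) x)

Terminal : Word → Word → Set
Terminal S R = ∀ x → ¬ Sortable S R x

AtLeast3Colors : Word → Set
AtLeast3Colors W = ∃[ c₁ ] ∃[ c₂ ] ∃[ c₃ ]
  (c₁ ∈ W × c₂ ∈ W × c₃ ∈ W × c₁ ≢ c₂ × c₁ ≢ c₃ × c₂ ≢ c₃)

TopTwo : Word → Color → Color → Set
TopTwo S b t = b ≢ t × ∃[ P ] ∃[ m ] (S ≡ P ++ b ∷ replicate (suc m) t)

{-# OPTIONS --safe #-}
module Submission where

-- Take for a the colour of the first sock of R whose colour occurs in S but is neither b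
-- nor t (any such colour of S if R has none), so every earlier sock of R is b, t or absent
-- from S. A colour x sortable in (abt, R) is t or occurs in R; if it occurs after that
-- a-sock, the sandwich a b a blocks it. Otherwise x is already sortable in (S, R): since S
-- has no sandwich, a sandwich u v u x of S R has at most two of u, v, u in S, and those
-- (recurring in R before x) can only be the top colours b, t, so u v u x ⊆ abt R as well.

open import Defs
open import Data.Nat using (suc; _≟_)
open import Data.List using ([]; _∷_; _++_; replicate)
open import Data.List.Properties using (++-assoc; ++-identityʳ)
open import Data.List.Membership.Propositional using (_∈_; _∉_)
open import Data.List.Membership.Propositional.Properties using (∈-++⁺ˡ; ∈-++⁺ʳ; ∈-++⁻)
open import Data.List.Membership.DecPropositional _≟_ using (_∈?_)
open import Data.List.Relation.Unary.Any using (here; there)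
open import Data.List.Relation.Unary.All as All using (All)
open import Data.List.Relation.Unary.All.Properties using (replicate⁺)
open import Data.List.Relation.Unary.First as First using (first)
open import Data.List.Relation.Unary.First.Properties using (toView)
open import Data.List.Relation.Binary.Sublist.Propositional
  using (_⊆_; []; _∷_; _∷ʳ_; minimum; ⊆-refl; ⊆-trans; from∈; to∈; lookup)
open import Data.List.Relation.Binary.Sublist.Propositional.Properties
  using (++⁺; ++⁺ˡ; ++⁺ʳ; ∷ˡ⁻; ∷ʳ⁻)
open import Data.Product using (∃; ∃₂; ∃-syntax; _×_; _,_; proj₂)
open import Data.Sum using (_⊎_; inj₁; inj₂)
open import Data.Empty using (⊥)
open import Function using (_∘_)
open import Relation.Nullary using (¬_; yes; no; contradiction)
open import Relation.Binary.PropositionalEquality using (_≡_; _≢_; refl; sym; trans; cong; subst)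

variable
  S R R₁ R₂ xs : Word
  a b t u v x y : Color

⊆-++-split : ∀ A {B} → xs ⊆ A ++ B → ∃₂ λ ys zs → xs ≡ ys ++ zs × ys ⊆ A × zs ⊆ B
⊆-++-split []      s        = [] , _ , refl , [] , s
⊆-++-split (a ∷ A) (_ ∷ʳ s) =
  let ys , zs , eq , s₁ , s₂ = ⊆-++-split A s in ys , zs , eq , a ∷ʳ s₁ , s₂
⊆-++-split (a ∷ A) (_∷_ {x = x} x≡a s) =
  let ys , zs , eq , s₁ , s₂ = ⊆-++-split A s in x ∷ ys , zs , cong (x ∷_) eq , x≡a ∷ s₁ , s₂

⊆-++ʳ-if-head∉ : ∀ A {B} → x ∉ A → x ∷ xs ⊆ A ++ B → x ∷ xs ⊆ B
⊆-++ʳ-if-head∉ []      x∉A s         = s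
⊆-++ʳ-if-head∉ (a ∷ A) x∉A (_ ∷ʳ s)  = ⊆-++ʳ-if-head∉ A (x∉A ∘ there) s
⊆-++ʳ-if-head∉ (a ∷ A) x∉A (x≡a ∷ s) = contradiction (here x≡a) x∉A

⊆-++ˡ-if-last∉ : ∀ xs A {B} → x ∉ B → xs ++ x ∷ [] ⊆ A ++ B → xs ++ x ∷ [] ⊆ A
⊆-++ˡ-if-last∉ xs       []      x∉B s         = contradiction (lookup s (∈-++⁺ʳ xs (here refl))) x∉B
⊆-++ˡ-if-last∉ []       (a ∷ A) x∉B (_ ∷ʳ s)  = a ∷ʳ ⊆-++ˡ-if-last∉ [] A x∉B s
⊆-++ˡ-if-last∉ []       (a ∷ A) x∉B (x≡a ∷ s) = x≡a ∷ minimum A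
⊆-++ˡ-if-last∉ (y ∷ xs) (a ∷ A) x∉B (_ ∷ʳ s)  = a ∷ʳ ⊆-++ˡ-if-last∉ (y ∷ xs) A x∉B s
⊆-++ˡ-if-last∉ (y ∷ xs) (a ∷ A) x∉B (y≡a ∷ s) = y≡a ∷ ⊆-++ˡ-if-last∉ xs A x∉B s

three-distinct⇒¬all-in-pair : ∀ {c₁ c₂ c₃} → c₁ ≢ c₂ → c₁ ≢ c₃ → c₂ ≢ c₃ →
  c₁ ≡ b ⊎ c₁ ≡ t → c₂ ≡ b ⊎ c₂ ≡ t → c₃ ≡ b ⊎ c₃ ≡ t → ⊥
three-distinct⇒¬all-in-pair c₁≢c₂ _ _ (inj₁ refl) (inj₁ refl) _ = c₁≢c₂ refl
three-distinct⇒¬all-in-pair c₁≢c₂ _ _ (inj₂ refl) (inj₂ refl) _ = c₁≢c₂ refl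
three-distinct⇒¬all-in-pair _ c₁≢c₃ _ (inj₁ refl) _ (inj₁ refl) = c₁≢c₃ refl
three-distinct⇒¬all-in-pair _ c₁≢c₃ _ (inj₂ refl) _ (inj₂ refl) = c₁≢c₃ refl
three-distinct⇒¬all-in-pair _ _ c₂≢c₃ _ (inj₁ refl) (inj₁ refl) = c₂≢c₃ refl
three-distinct⇒¬all-in-pair _ _ c₂≢c₃ _ (inj₂ refl) (inj₂ refl) = c₂≢c₃ refl

TopOrAbsent : Word → Color → Color → Color → Set
TopOrAbsent S b t y = y ∈ S → y ≡ b ⊎ y ≡ t

OtherColor : Word → Color → Color → Color → Set
OtherColor S b t y = y ∈ S × y ≢ b × y ≢ t

topOrAbsent⊎otherColor : ∀ S b t y → TopOrAbsent S b t y ⊎ OtherColor S b t y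
topOrAbsent⊎otherColor S b t y with y ∈? S | y ≟ b | y ≟ t
... | no y∉S   | _        | _        = inj₁ (λ y∈S → contradiction y∈S y∉S)
... | yes _    | yes y≡b  | _        = inj₁ (λ _ → inj₁ y≡b)
... | yes _    | no _     | yes y≡t  = inj₁ (λ _ → inj₂ y≡t)
... | yes y∈S  | no y≢b   | no y≢t   = inj₂ (y∈S , y≢b , y≢t)

otherColor : ∀ b t → AtLeast3Colors S → ∃ (OtherColor S b t)
otherColor {S} b t (c₁ , c₂ , c₃ , c₁∈S , c₂∈S , c₃∈S , c₁≢c₂ , c₁≢c₃ , c₂≢c₃)
  with topOrAbsent⊎otherColor S b t c₁
     | topOrAbsent⊎otherColor S b t c₂
     | topOrAbsent⊎otherColor S b t c₃
... | inj₂ other | _          | _          = c₁ , other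
... | _          | inj₂ other | _          = c₂ , other
... | _          | _          | inj₂ other = c₃ , other
... | inj₁ top₁  | inj₁ top₂  | inj₁ top₃  = contradiction (top₃ c₃∈S)
  λ c₃∈bt → three-distinct⇒¬all-in-pair c₁≢c₂ c₁≢c₃ c₂≢c₃ (top₁ c₁∈S) (top₂ c₂∈S) c₃∈bt

record StackTop (S : Word) (b t : Color) : Set where
  field
    b≢t     : b ≢ t
    t∈S     : t ∈ S
    above-t : (t ∷ y ∷ []) ⊆ S → y ≡ t
    above-b : v ≢ b → (b ∷ v ∷ []) ⊆ S → v ≡ t

stackTop : ¬ HasSandwich S → TopTwo S b t → StackTop S b t
stackTop {b = b} {t} noSandwich (b≢t , P , m , refl) = record
  { b≢t = b≢t ; t∈S = ∈-++⁺ʳ P (there (here refl)) ; above-t = above-t ; above-b = above-b }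
  where
  tops : Word
  tops = replicate (suc m) t

  ∈-tops : y ∈ tops → y ≡ t
  ∈-tops = All.lookup (replicate⁺ {P = _≡ t} (suc m) refl)

  ∈-b∷tops : v ≢ b → v ∈ b ∷ tops → v ≡ t
  ∈-b∷tops v≢b (here v≡b)   = contradiction v≡b v≢b
  ∈-b∷tops v≢b (there v∈tops) = ∈-tops v∈tops

  t∉P : t ∉ P
  t∉P t∈P = noSandwich (t , b , b≢t ∘ sym , ++⁺ (from∈ t∈P) (refl ∷ refl ∷ minimum _))

  above-t : (t ∷ y ∷ []) ⊆ P ++ b ∷ tops → y ≡ t
  above-t s = ∈-tops (to∈ (∷ˡ⁻ (∷ʳ⁻ (b≢t ∘ sym) (⊆-++ʳ-if-head∉ P t∉P s))))

  above-b : v ≢ b → (b ∷ v ∷ []) ⊆ P ++ b ∷ tops → v ≡ t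
  above-b v≢b s with ⊆-++-split P s
  ... | []          , _ , refl , _  , s₂ = ∈-b∷tops v≢b (to∈ (∷ˡ⁻ s₂))
  ... | _ ∷ []      , _ , refl , _  , s₂ = ∈-b∷tops v≢b (to∈ s₂)
  ... | _ ∷ _ ∷ []  , _ , refl , s₁ , _  =
    contradiction (b , _ , v≢b ∘ sym , ++⁺ s₁ (refl ∷ minimum tops)) noSandwich

sortable⇒≢a×≢b : a ≢ b → b ≢ t → Sortable (a ∷ b ∷ t ∷ []) R x → x ≢ a × x ≢ b
sortable⇒≢a×≢b {a} {b} {t} a≢b b≢t (_ , uncovered , _) = x≢a , x≢b
  where
  x≢a : _ ≢ a
  x≢a x≡a = uncovered b (λ b≡x → a≢b (sym (trans b≡x x≡a))) (x≡a ∷ refl ∷ t ∷ʳ [])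
  x≢b : _ ≢ b
  x≢b x≡b = uncovered t (λ t≡x → b≢t (sym (trans t≡x x≡b))) (a ∷ʳ x≡b ∷ refl ∷ [])

sortable-on-top⇒≡t⊎∈ : a ≢ b → b ≢ t → x ∉ R₂ →
  Sortable (a ∷ b ∷ t ∷ []) (R₁ ++ R₂) x → x ≡ t ⊎ x ∈ R₁
sortable-on-top⇒≡t⊎∈ {R₁ = R₁} a≢b b≢t x∉R₂ sx@(x∈abtR , _)
  with sortable⇒≢a×≢b a≢b b≢t sx | x∈abtR
... | x≢a , _ | here x≡a                  = contradiction x≡a x≢a
... | _ , x≢b | there (here x≡b)          = contradiction x≡b x≢b
... | _       | there (there (here x≡t))  = inj₁ x≡t
... | _       | there (there (there x∈R)) with ∈-++⁻ R₁ x∈R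
...   | inj₁ x∈R₁ = inj₂ x∈R₁
...   | inj₂ x∈R₂ = contradiction x∈R₂ x∉R₂

aba-blocks : a ≢ b → b ≢ t → x ∈ a ∷ R₂ → ¬ Sortable (a ∷ b ∷ t ∷ []) (R₁ ++ a ∷ R₂) x
aba-blocks {a} {b} {t} {x} {R₂} {R₁} a≢b b≢t x∈aR₂ sx@(_ , _ , unblocked)
  with sortable⇒≢a×≢b a≢b b≢t sx | x∈aR₂
... | x≢a , _   | here x≡a   = x≢a x≡a
... | x≢a , x≢b | there x∈R₂ =
  unblocked (∈-++⁺ʳ R₁ x∈aR₂) (a , b , a≢b , x≢a , x≢b , refl ∷ refl ∷ t ∷ʳ ++⁺ˡ R₁ (refl ∷ from∈ x∈R₂))

module _ (noSandwich : ¬ HasSandwich S) (top : StackTop S b t) where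
  open StackTop top

  uncovered-if-only-t : (x ∈ S → x ≡ t) → ∀ y → y ≢ x → ¬ (x ∷ y ∷ []) ⊆ S
  uncovered-if-only-t x∈S⇒x≡t y y≢x s with x∈S⇒x≡t (to∈ s)
  ... | refl = y≢x (above-t s)

  sandwich-on-top : All (TopOrAbsent S b t) R → u ≢ v →
    (u ∷ v ∷ u ∷ x ∷ []) ⊆ S ++ R → (u ∷ v ∷ u ∷ x ∷ []) ⊆ b ∷ t ∷ R
  sandwich-on-top absent u≢v s with ⊆-++-split S s
  ... | [] , _ , refl , _ , s₂ = b ∷ʳ t ∷ʳ s₂
  ... | _ ∷ [] , _ , refl , s₁ , s₂ with All.lookup absent (to∈ (∷ˡ⁻ s₂)) (to∈ s₁)
  ...   | inj₁ u≡b = u≡b ∷ t ∷ʳ s₂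
  ...   | inj₂ u≡t = b ∷ʳ u≡t ∷ s₂
  sandwich-on-top absent u≢v s | _ ∷ _ ∷ [] , _ , refl , s₁ , s₂ with All.lookup absent (to∈ s₂) (to∈ s₁)
  ...   | inj₁ refl = refl ∷ above-b (u≢v ∘ sym) s₁ ∷ s₂
  ...   | inj₂ refl = contradiction (sym (above-t s₁)) u≢v
  sandwich-on-top absent u≢v s | _ ∷ _ ∷ _ ∷ [] , _ , refl , s₁ , _ =
    contradiction (_ , _ , u≢v , s₁) noSandwich
  sandwich-on-top absent u≢v s | _ ∷ _ ∷ _ ∷ _ ∷ [] , _ , refl , s₁ , _ =
    contradiction (_ , _ , u≢v , ⊆-trans (++⁺ʳ _ ⊆-refl) s₁) noSandwich

  blocked-on-top : All (TopOrAbsent S b t) R₁ → x ∉ R₂ →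
    Blocked (S ++ R₁ ++ R₂) x → Blocked (a ∷ b ∷ t ∷ R₁ ++ R₂) x
  blocked-on-top {R₁} {x} {R₂} {a} absent x∉R₂ (u , v , u≢v , x≢u , x≢v , s) =
    u , v , u≢v , x≢u , x≢v , a ∷ʳ ++⁺ʳ R₂ (sandwich-on-top absent u≢v sandwich⊆SR₁)
    where
    sandwich⊆SR₁ : (u ∷ v ∷ u ∷ x ∷ []) ⊆ S ++ R₁
    sandwich⊆SR₁ = ⊆-++ˡ-if-last∉ (u ∷ v ∷ u ∷ []) (S ++ R₁) x∉R₂
      (subst ((u ∷ v ∷ u ∷ x ∷ []) ⊆_) (sym (++-assoc S R₁ R₂)) s)

  sortable-on-top⇒sortable : a ≢ b → All (TopOrAbsent S b t) R₁ → x ∉ R₂ →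
    Sortable (a ∷ b ∷ t ∷ []) (R₁ ++ R₂) x → Sortable S (R₁ ++ R₂) x
  sortable-on-top⇒sortable {a} {R₁} {x} {R₂} a≢b absent x∉R₂ sx@(_ , _ , unblocked) =
    x∈SR , uncovered-if-only-t x∈S⇒x≡t , λ x∈R → unblocked x∈R ∘ blocked-on-top absent x∉R₂
    where
    x≢b : x ≢ b
    x≢b = proj₂ (sortable⇒≢a×≢b a≢b b≢t sx)

    x≡t⊎x∈R₁ : x ≡ t ⊎ x ∈ R₁
    x≡t⊎x∈R₁ = sortable-on-top⇒≡t⊎∈ a≢b b≢t x∉R₂ sx

    x∈S⇒x≡t : x ∈ S → x ≡ t
    x∈S⇒x≡t x∈S with x≡t⊎x∈R₁
    ... | inj₁ x≡t  = x≡t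
    ... | inj₂ x∈R₁ with All.lookup absent x∈R₁ x∈S
    ...   | inj₁ x≡b = contradiction x≡b x≢b
    ...   | inj₂ x≡t = x≡t

    x∈SR : x ∈ S ++ R₁ ++ R₂
    x∈SR with x≡t⊎x∈R₁
    ... | inj₁ x≡t  = ∈-++⁺ˡ (subst (_∈ S) (sym x≡t) t∈S)
    ... | inj₂ x∈R₁ = ∈-++⁺ʳ S (∈-++⁺ˡ x∈R₁)

  terminal⇒terminal-on-top : a ≢ b → All (TopOrAbsent S b t) R₁ →
    (∀ x → x ∈ R₂ → ¬ Sortable (a ∷ b ∷ t ∷ []) (R₁ ++ R₂) x) →
    Terminal S (R₁ ++ R₂) → Terminal (a ∷ b ∷ t ∷ []) (R₁ ++ R₂)
  terminal⇒terminal-on-top {R₂ = R₂} a≢b absent ¬sortable-in-R₂ terminal x sx with x ∈? R₂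
  ... | yes x∈R₂ = ¬sortable-in-R₂ x x∈R₂ sx
  ... | no x∉R₂  = terminal x (sortable-on-top⇒sortable a≢b absent x∉R₂ sx)

  otherColor-on-top-terminal : AtLeast3Colors S → Terminal S R →
    ∃[ a ] (OtherColor S b t a × Terminal (a ∷ b ∷ t ∷ []) R)
  otherColor-on-top-terminal {R} three terminal with first (topOrAbsent⊎otherColor S b t) R
  ... | inj₁ firstOther with toView firstOther
  ...   | absent First.++ other@(_ , a≢b , _) ∷ R₂ =
    _ , other , terminal⇒terminal-on-top a≢b absent (λ _ → aba-blocks a≢b b≢t) terminal
  otherColor-on-top-terminal {R} three terminal | inj₂ absent with otherColor b t three
  ... | a , other@(_ , a≢b , _) =
    a , other , subst (Terminal _) (++-identityʳ R)
      (terminal⇒terminal-on-top a≢b absent (λ _ ()) (subst (Terminal S) (sym (++-identityʳ R)) terminal))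

lemma4p9 : (S R : Word) → ¬ HasSandwich S → AtLeast3Colors S → Terminal S R →
    (b t : Color) → TopTwo S b t →
    ∃[ a ] (a ∈ S × a ≢ b × a ≢ t × Terminal (a ∷ b ∷ t ∷ []) R)
lemma4p9 S R noSandwich three terminal b t topTwo =
  let a , (a∈S , a≢b , a≢t) , terminal-on-top =
        otherColor-on-top-terminal noSandwich (stackTop noSandwich topTwo) three terminal
  in a , a∈S , a≢b , a≢t , terminal-on-top
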